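{- Let $v\equiv 3\pmod{12}$ with $v=3p_1p_2\cdots p_s$, where the $p_i$ are distinct primes with $p_i\equiv\pm3\pmod 8$ for each $i$. If there exists an APS$(v,\alpha,\beta)$, then $\alpha,\beta\in\{v/3,2v/3\}$.
   Context: APS$(v,\alpha,\beta)$ ($v\equiv3\pmod4$, $\alpha,\beta$ nonzero in $\mathbb{Z}_v$): a set $\mathcal S$ of $(v-3)/4$ unordered pairs $\{x,y\}$ from $\mathbb{Z}_v$ with $\bigcup_{\{x,y\}\in\mathcal S}\pm\{x,y\}=\mathbb{Z}_v\setminus\{0,\pm\alpha\}$ and $\bigcup_{\{x,y\}\in\mathcal S}\pm\{x-y,x+y\}=\mathbb{Z}_v\setminus\{0,\pm\beta\}$. -}

module Defs where

open import Data.Nat using (ℕ; _+_; _*_; _∸_; _<_; _/_; _%_; NonZero)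
open import Data.Nat.Primality using (Prime)
open import Data.Product using (_×_; _,_; Σ; ∃; ∃-syntax)
open import Data.Sum using (_⊎_)
open import Data.List using (List; length)
open import Data.List.Relation.Unary.All using (All)
open import Data.List.Relation.Unary.AllPairs using (AllPairs)
open import Data.List.Relation.Unary.Unique.Propositional using (Unique)
open import Data.List.Membership.Propositional using (_∈_)
open import Relation.Binary.PropositionalEquality using (_≡_; _≢_)
open import Relation.Nullary using (¬_)
open import Function.Bundles using (_⇔_)

-- Arithmetic in ℤ_v, with ℤ_v represented by the naturals 0 … v-1.
module ZMod (v : ℕ) .{{_ : NonZero v}} where

  neg : ℕ → ℕ
  neg x = (v ∸ x) % v

  add : ℕ → ℕ → ℕ
  add x y = (x + y) % v

  sub : ℕ → ℕ → ℕ
  sub x y = (x + (v ∸ y)) % v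

  -- a pair {x,y} of elements of ℤ_v (stored as an ordered pair)
  Pair : Set
  Pair = ℕ × ℕ

  InZv : Pair → Set
  InZv (x , y) = (x < v) × (y < v)

  SamePair : Pair → Pair → Set
  SamePair (x , y) (x' , y') = ((x ≡ x') × (y ≡ y')) ⊎ ((x ≡ y') × (y ≡ x'))

  InPm : List Pair → ℕ → Set
  InPm S z = ∃[ p ] (p ∈ S × (let (x , y) = p in
               (z ≡ x) ⊎ (z ≡ y) ⊎ (z ≡ neg x) ⊎ (z ≡ neg y)))

  InPmDiffSum : List Pair → ℕ → Set
  InPmDiffSum S z = ∃[ p ] (p ∈ S × (let (x , y) = p in
               (z ≡ sub x y) ⊎ (z ≡ add x y) ⊎ (z ≡ neg (sub x y)) ⊎ (z ≡ neg (add x y))))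

  IsAPS : ℕ → ℕ → List Pair → Set
  IsAPS α β S =
      (length S ≡ (v ∸ 3) / 4)
    × All InZv S
    × AllPairs (λ p q → ¬ SamePair p q) S
    × (∀ z → z < v → (InPm S z ⇔ ((z ≢ 0) × (z ≢ α) × (z ≢ neg α))))
    × (∀ z → z < v → (InPmDiffSum S z ⇔ ((z ≢ 0) × (z ≢ β) × (z ≢ neg β))))

APS : (v : ℕ) .{{_ : NonZero v}} → ℕ → ℕ → Set
APS v α β =
    (v % 4 ≡ 3)
  × (α < v) × (α ≢ 0) × (β < v) × (β ≢ 0)
  × Σ (List (ZMod.Pair v)) (ZMod.IsAPS v α β)

PlusMinus3Mod8 : ℕ → Set
PlusMinus3Mod8 p = (p % 8 ≡ 3) ⊎ (p % 8 ≡ 5)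

module Submission where

-- Let P = v/3 and let p be one of the primes. Summing z² over ℤ_v once through the
-- elements ±x, ±y of the APS and once through ±(x−y), ±(x+y) gives, modulo v,
--   Σ_{z<v} z² ≡ 2α² + 2N ≡ 2β² + 4N,  where N = Σ_{{x,y}∈S} (x² + y²),
-- so Σ_{z<v} z² ≡ 2(2α² − β²). The left side is (v−1)v(2v−1)/6 = (v−1)P(2v−1)/2, hence
-- p | 2α² − β². For p = 2h + 1 ≡ ±3 (mod 8) the number 2 is a quadratic non-residue:
-- Gauss's lemma gives c^h ≡ ±1 (mod p) for every c prime to p, with the sign −1 for c = 2,
-- so 2α² ≡ β² forces p | α and then p | β. The primes being distinct, P divides α and β,
-- and 0 < α, β < 3P leaves only P and 2P.

module Lists where
  open import Data.Nat using (ℕ; suc; _≤_; z≤n; s≤s; s≤s⁻¹)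
  open import Data.Nat.Properties using (+-suc)
  open import Data.List using (List; []; _∷_; map; downFrom; length; _++_)
  open import Data.List.Properties using (length-++)
  open import Data.List.Membership.Propositional using (_∈_)
  open import Data.List.Membership.Propositional.Properties
    using (∈-map⁺; ∈-map⁻; ∈-downFrom⁺; ∈-downFrom⁻; ∈-∃++; ∈-++⁻; ∈-++⁺ˡ; ∈-++⁺ʳ)
  open import Data.List.Relation.Binary.Subset.Propositional using (_⊆_)
  open import Data.List.Relation.Binary.Permutation.Propositional
    using (_↭_; ↭-refl; ↭-prep; ↭-trans; ↭-sym)
  open import Data.List.Relation.Binary.Permutation.Propositional.Properties using (shift)
  open import Data.List.Relation.Unary.Any using (here; there)
  import Data.List.Relation.Unary.All as All
  import Data.List.Relation.Unary.All.Properties as All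
  open import Data.List.Relation.Unary.AllPairs using ([]; _∷_)
  open import Data.List.Relation.Unary.Unique.Propositional using (Unique)
  import Data.List.Relation.Unary.Unique.Propositional.Properties as Unique
  open import Data.Product using (_×_; _,_)
  open import Data.Sum using (inj₁; inj₂)
  open import Data.Empty using (⊥-elim)
  open import Relation.Binary.PropositionalEquality using (_≡_; refl)

  unique∧⊆∧length≥⇒↭ : ∀ {A : Set} (xs ys : List A) → Unique xs → xs ⊆ ys →
                      length ys ≤ length xs → xs ↭ ys
  unique∧⊆∧length≥⇒↭ []       []       _            _     _  = ↭-refl
  unique∧⊆∧length≥⇒↭ []       (_ ∷ _)  _            _     ()
  unique∧⊆∧length≥⇒↭ (x ∷ xs) ys       (x∉xs ∷ xs!) xs⊆ys |ys|≤ with ∈-∃++ (xs⊆ys (here refl))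
  ... | as , bs , refl =
    ↭-trans (↭-prep x (unique∧⊆∧length≥⇒↭ xs (as ++ bs) xs! xs⊆as++bs |as++bs|≤)) (↭-sym (shift x as bs))
    where
    xs⊆as++bs : xs ⊆ as ++ bs
    xs⊆as++bs y∈xs with ∈-++⁻ as (xs⊆ys (there y∈xs))
    ... | inj₁ y∈as         = ∈-++⁺ˡ y∈as
    ... | inj₂ (here refl)  = ⊥-elim (All.lookup x∉xs y∈xs refl)
    ... | inj₂ (there y∈bs) = ∈-++⁺ʳ as y∈bs
    |as++bs|≤ : length (as ++ bs) ≤ length xs
    |as++bs|≤ rewrite length-++ as {bs} | length-++ as {x ∷ bs} | +-suc (length as) (length bs)
      = s≤s⁻¹ |ys|≤

  unique-map-injectiveOn : ∀ {A B : Set} {f : A → B} {xs : List A} →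
                (∀ {x y} → x ∈ xs → y ∈ xs → f x ≡ f y → x ≡ y) → Unique xs → Unique (map f xs)
  unique-map-injectiveOn _   []           = []
  unique-map-injectiveOn inj (x∉xs ∷ xs!) =
    All.map⁺ (All.tabulate (λ y∈xs fx≡fy → All.lookup x∉xs y∈xs (inj (here refl) (there y∈xs) fx≡fy)))
    ∷ unique-map-injectiveOn (λ x∈ y∈ → inj (there x∈) (there y∈)) xs!

  [1‥_] : ℕ → List ℕ
  [1‥ n ] = map suc (downFrom n)

  ∈-[1‥]⁻ : ∀ {k n} → k ∈ [1‥ n ] → 1 ≤ k × k ≤ n
  ∈-[1‥]⁻ k∈ with ∈-map⁻ suc k∈
  ... | _ , j∈ , refl = s≤s z≤n , ∈-downFrom⁻ j∈

  ∈-[1‥]⁺ : ∀ {k n} → 1 ≤ k → k ≤ n → k ∈ [1‥ n ]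
  ∈-[1‥]⁺ {suc j} _ k≤n = ∈-map⁺ suc (∈-downFrom⁺ k≤n)

  [1‥]-unique : ∀ n → Unique [1‥ n ]
  [1‥]-unique n = Unique.map⁺ (λ { refl → refl }) (Unique.downFrom⁺ n)

module Congruence where
  open import Data.Nat using (ℕ; zero; suc; _≤_; _%_; _/_; _∸_; NonZero)
  open import Data.Nat.DivMod using (m≡m%n+[m/n]*n)
  open import Data.Integer using (ℤ; +_; _+_; _*_; -_; _-_; _^_; 0ℤ; 1ℤ)
  open import Data.Integer.Properties using (pos-+; pos-*; m-n≡m⊖n; ⊖-≥)
  open import Data.Integer.Divisibility.Signed
  open import Data.Integer.Tactic.RingSolver using (solve-∀)
  open import Relation.Binary.PropositionalEquality using (_≡_; refl; sym; trans; cong; subst)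
  open import Relation.Binary.Bundles using (Setoid)
  import Relation.Binary.Reasoning.Setoid as SetoidReasoning

  module Modulo (m : ℤ) where

    infix 4 _≈_
    record _≈_ (a b : ℤ) : Set where
      constructor mk
      field ∣-difference : m ∣ a - b
    open _≈_ public

    private
      respect : ∀ {a b} → a ≡ b → m ∣ a → m ∣ b
      respect = subst (m ∣_)

    ≈-refl : ∀ {a} → a ≈ a
    ≈-refl {a} = mk (divides 0ℤ (a-a≡0*m a m))
      where
      a-a≡0*m : ∀ a m → a - a ≡ 0ℤ * m
      a-a≡0*m = solve-∀

    ≈-reflexive : ∀ {a b} → a ≡ b → a ≈ b
    ≈-reflexive refl = ≈-refl

    ≈-sym : ∀ {a b} → a ≈ b → b ≈ a
    ≈-sym {a} {b} (mk d) = mk (respect (-[a-b]≡b-a a b) (∣m⇒∣-m d))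
      where
      -[a-b]≡b-a : ∀ a b → - (a - b) ≡ b - a
      -[a-b]≡b-a = solve-∀

    ≈-trans : ∀ {a b c} → a ≈ b → b ≈ c → a ≈ c
    ≈-trans {a} {b} {c} (mk d) (mk e) = mk (respect (telescope a b c) (∣m∣n⇒∣m+n d e))
      where
      telescope : ∀ a b c → (a - b) + (b - c) ≡ a - c
      telescope = solve-∀

    +-cong : ∀ {a b c d} → a ≈ b → c ≈ d → a + c ≈ b + d
    +-cong {a} {b} {c} {d} (mk x) (mk y) = mk (respect (interchange a b c d) (∣m∣n⇒∣m+n x y))
      where
      interchange : ∀ a b c d → (a - b) + (c - d) ≡ (a + c) - (b + d)
      interchange = solve-∀

    *-cong : ∀ {a b c d} → a ≈ b → c ≈ d → a * c ≈ b * d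
    *-cong {a} {b} {c} {d} (mk x) (mk y) =
      mk (respect (split a b c d) (∣m∣n⇒∣m+n (∣n⇒∣m*n c x) (∣n⇒∣m*n b y)))
      where
      split : ∀ a b c d → c * (a - b) + b * (c - d) ≡ a * c - b * d
      split = solve-∀

    -‿cong : ∀ {a b} → a ≈ b → - a ≈ - b
    -‿cong {a} {b} (mk x) = mk (respect (-[a-b]≡-a--b a b) (∣m⇒∣-m x))
      where
      -[a-b]≡-a--b : ∀ a b → - (a - b) ≡ - a - - b
      -[a-b]≡-a--b = solve-∀

    ≈-+-multiple : ∀ a k → a + k * m ≈ a
    ≈-+-multiple a k = mk (divides k (a+km-a≡km a k m))
      where
      a+km-a≡km : ∀ a k m → a + k * m - a ≡ k * m
      a+km-a≡km = solve-∀

    ^-cong : ∀ {a b} n → a ≈ b → a ^ n ≈ b ^ n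
    ^-cong zero    _   = ≈-refl
    ^-cong (suc n) a≈b = *-cong a≈b (^-cong n a≈b)

    ≈-setoid : Setoid _ _
    ≈-setoid = record
      { Carrier = ℤ ; _≈_ = _≈_
      ; isEquivalence = record { refl = ≈-refl ; sym = ≈-sym ; trans = ≈-trans } }

    module ≈-Reasoning = SetoidReasoning ≈-setoid

  module ModuloNat (m : ℕ) .{{_ : NonZero m}} where
    open Modulo (+ m) public

    %-≈ : ∀ n → + (n % m) ≈ + n
    %-≈ n = ≈-sym (≈-trans (≈-reflexive n≡) (≈-+-multiple (+ (n % m)) (+ (n / m))))
      where
      n≡ : + n ≡ + (n % m) + + (n / m) * + m
      n≡ = trans (cong +_ (m≡m%n+[m/n]*n n m))
                 (trans (pos-+ (n % m) _) (cong (λ z → + (n % m) + z) (pos-* (n / m) m)))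

    ∸-≈ : ∀ {x} → x ≤ m → + (m ∸ x) ≈ - + x
    ∸-≈ {x} x≤m = ≈-trans (≈-reflexive (trans m∸x≡ (m-x≡-x+1*m (+ m) (+ x)))) (≈-+-multiple (- + x) 1ℤ)
      where
      m∸x≡ : + (m ∸ x) ≡ + m - + x
      m∸x≡ = sym (trans (m-n≡m⊖n m x) (⊖-≥ x≤m))
      m-x≡-x+1*m : ∀ m x → m - x ≡ - x + 1ℤ * m
      m-x≡-x+1*m = solve-∀

module Primes where
  open import Data.Nat using (zero; suc; _<_; nonTrivial⇒n>1)
  open import Data.Nat.Divisibility using (_∣_; ∣⇒≤; ∣1⇒≡1)
  open import Data.Nat.Primality using (Prime; euclidsLemma; prime⇒nonTrivial)
  open import Data.Nat.Properties using (<⇒≱; <⇒≢)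
  open import Data.Nat.ListAction using (product)
  open import Data.Integer using (ℤ; +_; _*_; 0ℤ) renaming (∣_∣ to abs)
  open import Data.Integer.Properties using (abs-*; ∣i∣≡0⇒i≡0)
  import Data.Integer.Divisibility.Signed as ℤ
  open import Data.List.Relation.Unary.All using (All; []; _∷_)
  open import Data.Sum using (_⊎_; map; [_,_]′)
  open import Relation.Binary.PropositionalEquality using (_≡_; sym; subst)
  open import Relation.Nullary using (¬_)
  open import Data.Empty using (⊥-elim)

  prime∤product : ∀ {p} → Prime p → ∀ {ns} → All (λ n → ¬ p ∣ n) ns → ¬ p ∣ product ns
  prime∤product p-prime []           p∣1 =
    <⇒≢ (nonTrivial⇒n>1 _ {{prime⇒nonTrivial p-prime}}) (sym (∣1⇒≡1 p∣1))
  prime∤product p-prime (p∤n ∷ p∤ns) p∣n*ns =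
    [ p∤n , prime∤product p-prime p∤ns ]′ (euclidsLemma _ _ p-prime p∣n*ns)

  euclidsLemma-ℤ : ∀ {p} → Prime p → ∀ i j → + p ℤ.∣ i * j → + p ℤ.∣ i ⊎ + p ℤ.∣ j
  euclidsLemma-ℤ {p} p-prime i j p∣ij =
    map ℤ.∣ᵤ⇒∣ ℤ.∣ᵤ⇒∣ (euclidsLemma (abs i) (abs j) p-prime (subst (p ∣_) (abs-* i j) (ℤ.∣⇒∣ᵤ p∣ij)))

  ∣∧abs<⇒≡0 : ∀ {p i} → + p ℤ.∣ i → abs i < p → i ≡ 0ℤ
  ∣∧abs<⇒≡0 {p} {i} p∣i i<p with abs i in eq
  ... | zero  = ∣i∣≡0⇒i≡0 eq
  ... | suc _ = ⊥-elim (<⇒≱ i<p (∣⇒≤ (subst (p ∣_) eq (ℤ.∣⇒∣ᵤ p∣i))))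

module GaussLemma where
  open import Defs using (PlusMinus3Mod8)
  open Lists
  open Primes
  open Congruence
  open import Data.Nat as ℕ using (ℕ; zero; suc; _≤_; _<_; _≤?_; z≤n; s≤s; _%_; _/_; _∸_; >-nonZero)
  open import Data.Nat.Properties
    using ( ≤-refl; ≤-reflexive; ≤-trans; ≤-<-trans; <⇒≤; <⇒≱; ≰⇒>; n≤1+n; m≤m+n; m≤n+m
          ; +-identityʳ; +-suc; +-mono-≤; +-monoʳ-≤; ⊔-lub; ∸-monoʳ-≤; m+n∸n≡m; m<n⇒0<n∸m)
  open import Data.Nat.DivMod using (m%n<n; m<n⇒m%n≡m; m≡m%n+[m/n]*n)
  open import Data.Nat.Divisibility using (_∣_; _∣?_; ∣⇒≤; m%n≡0⇒n∣m)
  open import Data.Nat.Primality using (Prime; euclidsLemma)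
  open import Data.Nat.ListAction using (product)
  open import Data.Nat.ListAction.Properties using (product-↭)
  import Data.Nat.Tactic.RingSolver as ℕ-Solver
  open import Data.Integer using (ℤ; +_; _+_; _*_; -_; _-_; _^_; 1ℤ; -1ℤ; _◃_) renaming (∣_∣ to abs)
  open import Data.Integer.Properties
    using ( pos-+; pos-*; +-injective; *-comm; *-identityˡ; -1*i≡-i; neg-involutive; neg-distribʳ-*
          ; i-j≡0⇒i≡j; [+m]-[+n]≡m⊖n; ∣m⊝n∣≤m⊔n; +◃n≡+n; -◃n≡-n; ◃-distrib-*)
  import Data.Integer.Divisibility.Signed as ℤ
  open import Data.Integer.Tactic.RingSolver using (solve-∀)
  open import Data.Sign as Sign using (Sign)
  open import Data.Sign.Properties using (opposite-involutive)
  open import Data.List using (map)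
  open import Data.List.Properties using (length-map)
  open import Data.List.Membership.Propositional using (_∈_)
  open import Data.List.Membership.Propositional.Properties using (∈-map⁻)
  open import Data.List.Relation.Binary.Subset.Propositional using (_⊆_)
  open import Data.List.Relation.Binary.Permutation.Propositional using (_↭_)
  import Data.List.Relation.Unary.All as All
  open import Data.Product using (Σ; _,_; proj₁; proj₂)
  open import Data.Sum as Sum using (_⊎_; inj₁; inj₂)
  open import Data.Empty using (⊥-elim)
  open import Relation.Binary.PropositionalEquality
  open import Relation.Nullary using (¬_; yes; no)
  open import Function using (_∘_)

  ◃-same-or-opposite : ∀ s t n → t ◃ n ≡ s ◃ n ⊎ t ◃ n ≡ - (s ◃ n)
  ◃-same-or-opposite Sign.+ Sign.+ n = inj₁ refl
  ◃-same-or-opposite Sign.- Sign.- n = inj₁ refl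
  ◃-same-or-opposite Sign.+ Sign.- n = inj₂ (trans (-◃n≡-n n) (cong -_ (sym (+◃n≡+n n))))
  ◃-same-or-opposite Sign.- Sign.+ n = inj₂ (trans (+◃n≡+n n) (trans (sym (neg-involutive (+ n))) (cong -_ (sym (-◃n≡-n n)))))

  ^-distribʳ-* : ∀ i j n → (i * j) ^ n ≡ i ^ n * j ^ n
  ^-distribʳ-* i j zero    = refl
  ^-distribʳ-* i j (suc n) = trans (cong ((i * j) *_) (^-distribʳ-* i j n)) (swap-middle i j (i ^ n) (j ^ n))
    where
    swap-middle : ∀ a b x y → (a * b) * (x * y) ≡ (a * x) * (b * y)
    swap-middle = solve-∀

  ◃≡◃1* : ∀ s n → s ◃ n ≡ (s ◃ 1) * + n
  ◃≡◃1* Sign.+ n = trans (+◃n≡+n n) (sym (*-identityˡ (+ n)))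
  ◃≡◃1* Sign.- n = trans (-◃n≡-n n) (sym (-1*i≡-i (+ n)))

  ◃1-square : ∀ s → (s ◃ 1) * (s ◃ 1) ≡ 1ℤ
  ◃1-square Sign.+ = refl
  ◃1-square Sign.- = refl

  module Gauss (h : ℕ) (p-prime : Prime (suc (h ℕ.+ h))) where

    p : ℕ
    p = suc (h ℕ.+ h)

    open ModuloNat p

    h<p : h < p
    h<p = s≤s (m≤m+n h h)

    p∤[1‥h] : All.All (λ k → ¬ p ∣ k) [1‥ h ]
    p∤[1‥h] = All.tabulate p∤k
      where
      p∤k : ∀ {k} → k ∈ [1‥ h ] → ¬ p ∣ k
      p∤k k∈ p∣k with ∈-[1‥]⁻ k∈
      ... | 1≤k , k≤h = <⇒≱ (≤-<-trans k≤h h<p) (∣⇒≤ {{>-nonZero 1≤k}} p∣k)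

    p∤h! : ¬ p ∣ product [1‥ h ]
    p∤h! = prime∤product p-prime p∤[1‥h]

    fold : ℕ → ℕ
    fold r with r ≤? h
    ... | yes _ = r
    ... | no  _ = p ∸ r

    sign : ℕ → Sign
    sign r with r ≤? h
    ... | yes _ = Sign.+
    ... | no  _ = Sign.-

    ≈-sign◃fold : ∀ {r} → r ≤ p → + r ≈ sign r ◃ fold r
    ≈-sign◃fold {r} r≤p with r ≤? h
    ... | yes _ = ≈-reflexive (sym (+◃n≡+n r))
    ... | no  _ = ≈-trans (≈-trans (≈-reflexive (sym (neg-involutive (+ r)))) (-‿cong (≈-sym (∸-≈ r≤p))))
                          (≈-reflexive (sym (-◃n≡-n (p ∸ r))))

    fold-∈ : ∀ {r} → 1 ≤ r → r < p → fold r ∈ [1‥ h ]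
    fold-∈ {r} 1≤r r<p with r ≤? h
    ... | yes r≤h = ∈-[1‥]⁺ 1≤r r≤h
    ... | no  r≰h = ∈-[1‥]⁺ (m<n⇒0<n∸m r<p) (≤-trans (∸-monoʳ-≤ p (≰⇒> r≰h)) (≤-reflexive (m+n∸n≡m h h)))

    cancel : ∀ {c} → ¬ p ∣ c → ∀ {i j} → + c * i ≈ + c * j → i ≈ j
    cancel {c} p∤c {i} {j} (mk p∣ci-cj)
      with euclidsLemma-ℤ p-prime (+ c) (i - j) (subst (+ p ℤ.∣_) (factor (+ c) i j) p∣ci-cj)
      where
      factor : ∀ c i j → c * i - c * j ≡ c * (i - j)
      factor = solve-∀
    ... | inj₁ p∣c   = ⊥-elim (p∤c (ℤ.∣⇒∣ᵤ p∣c))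
    ... | inj₂ p∣i-j = mk p∣i-j

    ≈⇒≡ : ∀ {k l} → k ≤ h → l ≤ h → + k ≈ + l → k ≡ l
    ≈⇒≡ {k} {l} k≤h l≤h (mk p∣k-l) = +-injective (i-j≡0⇒i≡j _ _ (∣∧abs<⇒≡0 p∣k-l |k-l|<p))
      where
      |k-l|<p : abs (+ k - + l) < p
      |k-l|<p rewrite [+m]-[+n]≡m⊖n k l = ≤-<-trans (∣m⊝n∣≤m⊔n k l) (≤-<-trans (⊔-lub k≤h l≤h) h<p)

    ≉-neg : ∀ {k l} → 1 ≤ k → k ≤ h → l ≤ h → ¬ (+ k ≈ - + l)
    ≉-neg {suc k} {l} _ k≤h l≤h (mk p∣k+l)
      with ∣∧abs<⇒≡0 (subst (+ p ℤ.∣_) (trans (sub-neg (+ suc k) (+ l)) (sym (pos-+ (suc k) l))) p∣k+l) k+l<p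
      where
      sub-neg : ∀ i j → i - - j ≡ i + j
      sub-neg = solve-∀
      k+l<p : suc k ℕ.+ l < p
      k+l<p = s≤s (+-mono-≤ k≤h l≤h)
    ... | ()

    module Multiplier (c : ℕ) (p∤c : ¬ p ∣ c) where

      residue : ℕ → ℕ
      residue k = (c ℕ.* k) % p

      c-fold : ℕ → ℕ
      c-fold k = fold (residue k)

      c-sign : ℕ → Sign
      c-sign k = sign (residue k)

      c*k≈ : ∀ k → + c * + k ≈ c-sign k ◃ c-fold k
      c*k≈ k = ≈-trans (≈-reflexive (sym (pos-* c k)))
                (≈-trans (≈-sym (%-≈ (c ℕ.* k))) (≈-sign◃fold (<⇒≤ (m%n<n (c ℕ.* k) p))))

      c-fold-∈ : ∀ {k} → k ∈ [1‥ h ] → c-fold k ∈ [1‥ h ]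
      c-fold-∈ {k} k∈ = fold-∈ 1≤residue (m%n<n (c ℕ.* k) p)
        where
        1≤residue : 1 ≤ residue k
        1≤residue with residue k in eq
        ... | suc _ = s≤s z≤n
        ... | zero with euclidsLemma c k p-prime (m%n≡0⇒n∣m (c ℕ.* k) p eq)
        ...   | inj₁ p∣c = ⊥-elim (p∤c p∣c)
        ...   | inj₂ p∣k = ⊥-elim (All.lookup p∤[1‥h] k∈ p∣k)

      c-fold-collision : ∀ {k l} → c-fold k ≡ c-fold l → + c * + k ≈ + c * + l ⊎ + c * + l ≈ + c * - + k
      c-fold-collision {k} {l} same =
        Sum.map (λ eq → ≈-trans (c*k≈ k) (≈-sym (≈-trans c*l≈ (≈-reflexive eq))))
                (λ eq → ≈-trans c*l≈ (≈-trans (≈-reflexive eq) c*-k≈))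
                (◃-same-or-opposite (c-sign k) (c-sign l) (c-fold k))
        where
        c*l≈ : + c * + l ≈ c-sign l ◃ c-fold k
        c*l≈ = subst (λ f → + c * + l ≈ c-sign l ◃ f) (sym same) (c*k≈ l)
        c*-k≈ : - (c-sign k ◃ c-fold k) ≈ + c * - + k
        c*-k≈ = ≈-trans (-‿cong (≈-sym (c*k≈ k))) (≈-reflexive (neg-distribʳ-* (+ c) (+ k)))

      c-fold-injective : ∀ {k l} → k ∈ [1‥ h ] → l ∈ [1‥ h ] → c-fold k ≡ c-fold l → k ≡ l
      c-fold-injective k∈ l∈ same =
        Sum.[ (λ ck≈cl → ≈⇒≡ k≤h l≤h (cancel p∤c ck≈cl))
            , (λ cl≈-ck → ⊥-elim (≉-neg (proj₁ (∈-[1‥]⁻ l∈)) l≤h k≤h (cancel p∤c cl≈-ck))) ]′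
          (c-fold-collision same)
        where
        k≤h = proj₂ (∈-[1‥]⁻ k∈)
        l≤h = proj₂ (∈-[1‥]⁻ l∈)

      c-fold-↭ : map c-fold [1‥ h ] ↭ [1‥ h ]
      c-fold-↭ = unique∧⊆∧length≥⇒↭ _ _ (unique-map-injectiveOn c-fold-injective ([1‥]-unique h)) c-folds⊆
                   (≤-reflexive (sym (length-map c-fold [1‥ h ])))
        where
        c-folds⊆ : map c-fold [1‥ h ] ⊆ [1‥ h ]
        c-folds⊆ f∈ with ∈-map⁻ c-fold f∈
        ... | _ , k∈ , refl = c-fold-∈ k∈

      signProduct : ℕ → Sign
      signProduct zero    = Sign.+
      signProduct (suc n) = c-sign (suc n) Sign.* signProduct n

      c^n*n!≈ : ∀ n → (+ c) ^ n * + product [1‥ n ] ≈ signProduct n ◃ product (map c-fold [1‥ n ])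
      c^n*n!≈ zero    = ≈-refl
      c^n*n!≈ (suc n) = begin
        (+ c) ^ suc n * + product [1‥ suc n ]
          ≡⟨ trans (cong ((+ c) ^ suc n *_) (pos-* (suc n) (product [1‥ n ])))
                   (swap-middle (+ c) ((+ c) ^ n) (+ suc n) (+ product [1‥ n ])) ⟩
        (+ c * + suc n) * ((+ c) ^ n * + product [1‥ n ])
          ≈⟨ *-cong (c*k≈ (suc n)) (c^n*n!≈ n) ⟩
        (c-sign (suc n) ◃ c-fold (suc n)) * (signProduct n ◃ product (map c-fold [1‥ n ]))
          ≡⟨ sym (◃-distrib-* (c-sign (suc n)) (signProduct n) (c-fold (suc n)) _) ⟩
        signProduct (suc n) ◃ product (map c-fold [1‥ suc n ]) ∎
        where
        open ≈-Reasoning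
        swap-middle : ∀ a b x y → (a * b) * (x * y) ≡ (a * x) * (b * y)
        swap-middle = solve-∀

      gauss : (+ c) ^ h * + product [1‥ h ] ≈ signProduct h ◃ product [1‥ h ]
      gauss = ≈-trans (c^n*n!≈ h) (≈-reflexive (cong (signProduct h ◃_) (product-↭ c-fold-↭)))

      c^h≈signProduct : (+ c) ^ h ≈ signProduct h ◃ 1
      c^h≈signProduct = cancel p∤h! {(+ c) ^ h} {signProduct h ◃ 1}
        (≈-trans (≈-reflexive (*-comm (+ F) ((+ c) ^ h)))
        (≈-trans gauss
                 (≈-reflexive (trans (◃≡◃1* (signProduct h) F) (*-comm (signProduct h ◃ 1) (+ F))))))
        where
        F = product [1‥ h ]

    c^h≈±1 : ∀ {c} → ¬ p ∣ c → Σ Sign (λ s → (+ c) ^ h ≈ s ◃ 1)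
    c^h≈±1 {c} p∤c = _ , Multiplier.c^h≈signProduct c p∤c

    sign-≤ : ∀ {r} → r ≤ h → sign r ≡ Sign.+
    sign-≤ {r} r≤h with r ≤? h
    ... | yes _   = refl
    ... | no  r≰h = ⊥-elim (r≰h r≤h)

    sign-> : ∀ {r} → ¬ r ≤ h → sign r ≡ Sign.-
    sign-> {r} r≰h with r ≤? h
    ... | yes r≤h = ⊥-elim (r≰h r≤h)
    ... | no  _   = refl

    minus^ : ℕ → Sign
    minus^ zero    = Sign.+
    minus^ (suc j) = Sign.opposite (minus^ j)

    minus^-odd : ∀ q → minus^ (suc (q ℕ.+ q)) ≡ Sign.-
    minus^-odd zero    = refl
    minus^-odd (suc q) rewrite +-suc q q = trans (opposite-involutive _) (minus^-odd q)

    -- t = ⌊h/2⌋: the residue 2k exceeds h exactly for the h − t = 2q + 1 values k > t.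
    module Two (t q : ℕ) (t+t≤h : t ℕ.+ t ≤ h) (h≤t+t+1 : h ≤ suc (t ℕ.+ t))
               (h≡t+odd : h ≡ t ℕ.+ suc (q ℕ.+ q)) where

      p∤2 : ¬ p ∣ 2
      p∤2 p∣2 = <⇒≱ 2<p (∣⇒≤ p∣2)
        where
        2<p : 2 < p
        2<p = s≤s (+-mono-≤ 1≤h 1≤h)
          where
          1≤h : 1 ≤ h
          1≤h = subst (1 ≤_) (sym h≡t+odd) (≤-trans (s≤s z≤n) (m≤n+m (suc (q ℕ.+ q)) t))

      open Multiplier 2 p∤2

      two* : ∀ k → 2 ℕ.* k ≡ k ℕ.+ k
      two* k = cong (k ℕ.+_) (+-identityʳ k)

      residue≡2k : ∀ {k} → k ≤ h → residue k ≡ 2 ℕ.* k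
      residue≡2k {k} k≤h = m<n⇒m%n≡m (s≤s (≤-trans (≤-reflexive (two* k)) (+-mono-≤ k≤h k≤h)))

      c-sign-≤t : ∀ {k} → k ≤ t → c-sign k ≡ Sign.+
      c-sign-≤t {k} k≤t = trans (cong sign (residue≡2k (≤-trans k≤t (≤-trans (m≤m+n t t) t+t≤h))))
                                (sign-≤ (≤-trans (≤-reflexive (two* k)) (≤-trans (+-mono-≤ k≤t k≤t) t+t≤h)))

      c-sign->t : ∀ {k} → t < k → k ≤ h → c-sign k ≡ Sign.-
      c-sign->t {k} t<k k≤h = trans (cong sign (residue≡2k k≤h)) (sign-> (λ 2k≤h → <⇒≱ (h<2k) 2k≤h))
        where
        h<2k : h < 2 ℕ.* k
        h<2k = ≤-trans (s≤s h≤t+t+1) (≤-trans (≤-reflexive (cong suc (sym (+-suc t t))))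
                                                  (≤-trans (+-mono-≤ t<k t<k) (≤-reflexive (sym (two* k)))))

      signProduct-≤t : ∀ n → n ≤ t → signProduct n ≡ Sign.+
      signProduct-≤t zero    _   = refl
      signProduct-≤t (suc n) n<t
        rewrite c-sign-≤t n<t | signProduct-≤t n (≤-trans (n≤1+n n) n<t) = refl

      signProduct-t+ : ∀ j → t ℕ.+ j ≤ h → signProduct (t ℕ.+ j) ≡ minus^ j
      signProduct-t+ zero    _ rewrite +-identityʳ t = signProduct-≤t t ≤-refl
      signProduct-t+ (suc j) t+j<h rewrite +-suc t j
        | c-sign->t (s≤s (m≤m+n t j)) t+j<h | signProduct-t+ j (≤-trans (n≤1+n _) t+j<h) = refl

      2^h≈-1 : (+ 2) ^ h ≈ -1ℤ
      2^h≈-1 = ≈-trans c^h≈signProduct (≈-reflexive (cong (_◃ 1) signProduct-h))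
        where
        signProduct-h : signProduct h ≡ Sign.-
        signProduct-h = subst (λ n → signProduct n ≡ Sign.-) (sym h≡t+odd)
                              (trans (signProduct-t+ (suc (q ℕ.+ q)) (≤-reflexive (sym h≡t+odd))) (minus^-odd q))

      two-nonresidue : ∀ a b → + p ℤ.∣ + 2 * (+ a * + a) - + b * + b → p ∣ a
      two-nonresidue a b p∣2a²-b² with p ∣? a
      ... | yes p∣a = p∣a
      ... | no  p∤a = ⊥-elim (p∤2 (ℤ.∣⇒∣ᵤ (∣-difference 1≈-1)))
        where
        A B : ℤ
        A = + a
        B = + b

        b²≈2a² : B * B ≈ + 2 * (A * A)
        b²≈2a² = ≈-sym (mk p∣2a²-b²)

        p∤b : ¬ p ∣ b
        p∤b p∣b with euclidsLemma-ℤ p-prime (+ 2) (A * A) (ℤ.∣m+n∣n⇒∣m p∣2a²-b² p∣-b²)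
          where
          p∣-b² : + p ℤ.∣ - (B * B)
          p∣-b² = ℤ.∣m⇒∣-m (ℤ.∣m⇒∣m*n {m = B} B (ℤ.∣ᵤ⇒∣ {+ p} {B} p∣b))
        ... | inj₁ p∣2 = p∤2 (ℤ.∣⇒∣ᵤ p∣2)
        ... | inj₂ p∣a² = Sum.[ p∤A , p∤A ]′ (euclidsLemma-ℤ p-prime A A p∣a²)
          where
          p∤A : ¬ + p ℤ.∣ A
          p∤A = p∤a ∘ ℤ.∣⇒∣ᵤ

        1≈-1 : 1ℤ ≈ -1ℤ
        1≈-1 = begin
          1ℤ                          ≡⟨ sym (◃1-square sb) ⟩
          (sb ◃ 1) * (sb ◃ 1)         ≈⟨ ≈-sym (*-cong Bʰ≈sb Bʰ≈sb) ⟩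
          B ^ h * B ^ h               ≡⟨ sym (^-distribʳ-* B B h) ⟩
          (B * B) ^ h                 ≈⟨ ^-cong h b²≈2a² ⟩
          (+ 2 * (A * A)) ^ h         ≡⟨ trans (^-distribʳ-* (+ 2) (A * A) h) (cong ((+ 2) ^ h *_) (^-distribʳ-* A A h)) ⟩
          (+ 2) ^ h * (A ^ h * A ^ h) ≈⟨ *-cong 2^h≈-1 (*-cong Aʰ≈sa Aʰ≈sa) ⟩
          -1ℤ * ((sa ◃ 1) * (sa ◃ 1)) ≡⟨ cong (-1ℤ *_) (◃1-square sa) ⟩
          -1ℤ                         ∎
          where
          open ≈-Reasoning
          sa sb : Sign
          sa = proj₁ (c^h≈±1 p∤a)
          sb = proj₁ (c^h≈±1 p∤b)
          Aʰ≈sa : A ^ h ≈ sa ◃ 1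
          Aʰ≈sa = proj₂ (c^h≈±1 p∤a)
          Bʰ≈sb : B ^ h ≈ sb ◃ 1
          Bʰ≈sb = proj₂ (c^h≈±1 p∤b)

  two-nonresidue-at : ∀ {p} h t q → p ≡ suc (h ℕ.+ h) → t ℕ.+ t ≤ h → h ≤ suc (t ℕ.+ t) →
                      h ≡ t ℕ.+ suc (q ℕ.+ q) → Prime p →
                      ∀ a b → + p ℤ.∣ + 2 * (+ a * + a) - + b * + b → p ∣ a
  two-nonresidue-at h t q refl t+t≤h h≤t+t+1 h≡ p-prime =
    Gauss.Two.two-nonresidue h p-prime t q t+t≤h h≤t+t+1 h≡

  two-nonresidue : ∀ {p} → Prime p → PlusMinus3Mod8 p →
                   ∀ a b → + p ℤ.∣ + 2 * (+ a * + a) - + b * + b → p ∣ a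
  two-nonresidue {p} p-prime (inj₁ p%8≡3) =
    two-nonresidue-at h t Q p≡ (+-monoʳ-≤ t (n≤1+n t)) (≤-reflexive (+-suc t t)) refl p-prime
    where
    Q t h : ℕ
    Q = p / 8
    t = Q ℕ.+ Q
    h = t ℕ.+ suc t
    p≡ : p ≡ suc (h ℕ.+ h)
    p≡ = trans (m≡m%n+[m/n]*n p 8) (trans (cong (ℕ._+ Q ℕ.* 8) p%8≡3) (3+Q*8≡2h+1 Q))
      where
      3+Q*8≡2h+1 : ∀ Q → 3 ℕ.+ Q ℕ.* 8 ≡ suc ((Q ℕ.+ Q ℕ.+ suc (Q ℕ.+ Q)) ℕ.+ (Q ℕ.+ Q ℕ.+ suc (Q ℕ.+ Q)))
      3+Q*8≡2h+1 = ℕ-Solver.solve-∀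
  two-nonresidue {p} p-prime (inj₂ p%8≡5) =
    two-nonresidue-at h t Q p≡ ≤-refl (n≤1+n h) refl p-prime
    where
    Q t h : ℕ
    Q = p / 8
    t = suc (Q ℕ.+ Q)
    h = t ℕ.+ t
    p≡ : p ≡ suc (h ℕ.+ h)
    p≡ = trans (m≡m%n+[m/n]*n p 8) (trans (cong (ℕ._+ Q ℕ.* 8) p%8≡5) (5+Q*8≡2h+1 Q))
      where
      5+Q*8≡2h+1 : ∀ Q → 5 ℕ.+ Q ℕ.* 8 ≡ suc ((suc (Q ℕ.+ Q) ℕ.+ suc (Q ℕ.+ Q)) ℕ.+ (suc (Q ℕ.+ Q) ℕ.+ suc (Q ℕ.+ Q)))
      5+Q*8≡2h+1 = ℕ-Solver.solve-∀

module SquareSums where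
  open import Defs using (module ZMod)
  open Lists using (unique∧⊆∧length≥⇒↭)
  open Congruence
  open import Data.Nat as ℕ using (ℕ; zero; suc; _≤_; _<_; _∸_; _/_; _%_; NonZero)
  open import Data.Nat.Properties using (<⇒≤; ≤-reflexive; m+n∸m≡n)
  open import Data.Nat.DivMod using (m%n<n; m≡m%n+[m/n]*n; m*n/n≡m)
  open import Data.Integer using (ℤ; +_; _+_; _*_; -_; _-_; 0ℤ)
  open import Data.Integer.Properties using (pos-+)
  open import Data.Integer.Tactic.RingSolver using (solve-∀)
  open import Data.List using (List; []; _∷_; length; downFrom)
  open import Data.List.Properties using (length-downFrom)
  open import Data.List.Membership.Propositional using (_∈_)
  open import Data.List.Membership.Propositional.Properties using (∈-downFrom⁻)
  open import Data.List.Relation.Binary.Permutation.Propositional using (_↭_; refl; prep; swap; trans)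
  open import Data.List.Relation.Unary.All using (All; []; _∷_)
  open import Data.List.Relation.Unary.Any using (here; there)
  open import Data.List.Relation.Unary.Unique.Propositional.Properties using (downFrom⁺)
  open import Data.Product using (_×_; _,_)
  open import Data.Sum using (inj₁; inj₂)
  open import Function using (_∘_)
  open import Function.Bundles using (Equivalence)
  open import Relation.Binary.PropositionalEquality as ≡ using (_≡_; _≢_; cong)
  open import Relation.Nullary using (yes; no)

  sumSq : List ℕ → ℤ
  sumSq []       = 0ℤ
  sumSq (z ∷ zs) = + z * + z + sumSq zs

  sumSq-↭ : ∀ {xs ys} → xs ↭ ys → sumSq xs ≡ sumSq ys
  sumSq-↭ refl                 = ≡.refl
  sumSq-↭ (prep x xs↭ys)       = cong (λ s → + x * + x + s) (sumSq-↭ xs↭ys)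
  sumSq-↭ (swap x y xs↭ys)     =
    ≡.trans (left-comm (+ x * + x) (+ y * + y) _) (cong (λ s → + y * + y + (+ x * + x + s)) (sumSq-↭ xs↭ys))
    where
    left-comm : ∀ a b c → a + (b + c) ≡ b + (a + c)
    left-comm = solve-∀
  sumSq-↭ (trans xs↭ys ys↭zs) = ≡.trans (sumSq-↭ xs↭ys) (sumSq-↭ ys↭zs)

  module _ (v : ℕ) .{{_ : NonZero v}} where
    open ZMod v
    open ModuloNat v

    neg-≈ : ∀ {x} → x ≤ v → + (neg x) ≈ - + x
    neg-≈ {x} x≤v = ≈-trans (%-≈ (v ∸ x)) (∸-≈ x≤v)

    add-≈ : ∀ x y → + (add x y) ≈ + x + + y
    add-≈ x y = ≈-trans (%-≈ (x ℕ.+ y)) (≈-reflexive (pos-+ x y))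

    sub-≈ : ∀ x {y} → y ≤ v → + (sub x y) ≈ + x - + y
    sub-≈ x {y} y≤v = ≈-trans (%-≈ (x ℕ.+ (v ∸ y))) (≈-trans (≈-reflexive (pos-+ x (v ∸ y))) (+-cong (≈-refl {+ x}) (∸-≈ y≤v)))

    square-cong : ∀ {a b} → a ≈ b → a * a ≈ b * b
    square-cong a≈b = *-cong a≈b a≈b

    ±pairs : List Pair → List ℕ
    ±pairs []            = []
    ±pairs ((x , y) ∷ S) = x ∷ y ∷ neg x ∷ neg y ∷ ±pairs S

    ±diffSums : List Pair → List ℕ
    ±diffSums []            = []
    ±diffSums ((x , y) ∷ S) = sub x y ∷ add x y ∷ neg (sub x y) ∷ neg (add x y) ∷ ±diffSums S

    pairNorm : List Pair → ℤ
    pairNorm []            = 0ℤ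
    pairNorm ((x , y) ∷ S) = + x * + x + + y * + y + pairNorm S

    length-±pairs : ∀ S → length (±pairs S) ≡ length S ℕ.* 4
    length-±pairs []      = ≡.refl
    length-±pairs (_ ∷ S) = cong (λ n → suc (suc (suc (suc n)))) (length-±pairs S)

    length-±diffSums : ∀ S → length (±diffSums S) ≡ length S ℕ.* 4
    length-±diffSums []      = ≡.refl
    length-±diffSums (_ ∷ S) = cong (λ n → suc (suc (suc (suc n)))) (length-±diffSums S)

    InPm⇒∈ : ∀ {S z} → InPm S z → z ∈ ±pairs S
    InPm⇒∈ (_ , here ≡.refl , inj₁ ≡.refl)                         = here ≡.refl
    InPm⇒∈ (_ , here ≡.refl , inj₂ (inj₁ ≡.refl))                  = there (here ≡.refl)
    InPm⇒∈ (_ , here ≡.refl , inj₂ (inj₂ (inj₁ ≡.refl)))           = there (there (here ≡.refl))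
    InPm⇒∈ (_ , here ≡.refl , inj₂ (inj₂ (inj₂ ≡.refl)))           = there (there (there (here ≡.refl)))
    InPm⇒∈ {_ ∷ _} (q , there q∈S , z∈±q) = there (there (there (there (InPm⇒∈ (q , q∈S , z∈±q)))))

    InPmDiffSum⇒∈ : ∀ {S z} → InPmDiffSum S z → z ∈ ±diffSums S
    InPmDiffSum⇒∈ (_ , here ≡.refl , inj₁ ≡.refl)                  = here ≡.refl
    InPmDiffSum⇒∈ (_ , here ≡.refl , inj₂ (inj₁ ≡.refl))           = there (here ≡.refl)
    InPmDiffSum⇒∈ (_ , here ≡.refl , inj₂ (inj₂ (inj₁ ≡.refl)))    = there (there (here ≡.refl))
    InPmDiffSum⇒∈ (_ , here ≡.refl , inj₂ (inj₂ (inj₂ ≡.refl)))    = there (there (there (here ≡.refl)))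
    InPmDiffSum⇒∈ {_ ∷ _} (q , there q∈S , z∈±q) =
      there (there (there (there (InPmDiffSum⇒∈ (q , q∈S , z∈±q)))))

    sumSq-±pairs : ∀ {S} → All InZv S → sumSq (±pairs S) ≈ + 2 * pairNorm S
    sumSq-±pairs []                             = ≈-refl
    sumSq-±pairs {(x , y) ∷ S} ((x<v , y<v) ∷ S<v) =
      ≈-trans (+-cong (≈-refl {+ x * + x}) (+-cong (≈-refl {+ y * + y}) (+-cong (square-cong (neg-≈ (<⇒≤ x<v)))
                              (+-cong (square-cong (neg-≈ (<⇒≤ y<v))) (sumSq-±pairs S<v)))))
              (≈-reflexive (regroup (+ x) (+ y) (pairNorm S)))
      where
      regroup : ∀ x y n → x * x + (y * y + (- x * - x + (- y * - y + + 2 * n))) ≡ + 2 * (x * x + y * y + n)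
      regroup = solve-∀

    sumSq-±diffSums : ∀ {S} → All InZv S → sumSq (±diffSums S) ≈ + 4 * pairNorm S
    sumSq-±diffSums []                             = ≈-refl
    sumSq-±diffSums {(x , y) ∷ S} ((_ , y<v) ∷ S<v) =
      ≈-trans (+-cong (square-cong x-y) (+-cong (square-cong x+y)
              (+-cong (square-cong (≈-trans (neg-≈ (<⇒≤ (m%n<n _ v))) (-‿cong x-y)))
              (+-cong (square-cong (≈-trans (neg-≈ (<⇒≤ (m%n<n _ v))) (-‿cong x+y))) (sumSq-±diffSums S<v)))))
              (≈-reflexive (regroup (+ x) (+ y) (pairNorm S)))
      where
      x-y : + (sub x y) ≈ + x - + y
      x-y = sub-≈ x (<⇒≤ y<v)
      x+y : + (add x y) ≈ + x + + y
      x+y = add-≈ x y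
      regroup : ∀ x y n → (x - y) * (x - y) + ((x + y) * (x + y) + (- (x - y) * - (x - y)
                          + (- (x + y) * - (x + y) + + 4 * n))) ≡ + 4 * (x * x + y * y + n)
      regroup = solve-∀

    downFrom-↭ : ∀ γ qs → 3 ℕ.+ length qs ≡ v → (∀ z → z < v → z ≢ 0 × z ≢ γ × z ≢ neg γ → z ∈ qs) →
                 downFrom v ↭ 0 ∷ γ ∷ neg γ ∷ qs
    downFrom-↭ γ qs 3+|qs|≡v covers =
      unique∧⊆∧length≥⇒↭ (downFrom v) _ (downFrom⁺ v) ⊆ (≤-reflexive (≡.trans 3+|qs|≡v (≡.sym (length-downFrom v))))
      where
      ⊆ : ∀ {z} → z ∈ downFrom v → z ∈ 0 ∷ γ ∷ neg γ ∷ qs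
      ⊆ {z} z∈ with z ℕ.≟ 0 | z ℕ.≟ γ | z ℕ.≟ neg γ
      ... | yes ≡.refl | _          | _          = here ≡.refl
      ... | no _       | yes ≡.refl | _          = there (here ≡.refl)
      ... | no _       | no _       | yes ≡.refl = there (there (here ≡.refl))
      ... | no z≢0     | no z≢γ     | no z≢-γ    = there (there (there (covers z (∈-downFrom⁻ z∈) (z≢0 , z≢γ , z≢-γ))))

    sumSq-complement : ∀ {γ} qs → γ < v → 3 ℕ.+ length qs ≡ v →
                       (∀ z → z < v → z ≢ 0 × z ≢ γ × z ≢ neg γ → z ∈ qs) →
                       sumSq (downFrom v) ≈ + 2 * (+ γ * + γ) + sumSq qs
    sumSq-complement {γ} qs γ<v 3+|qs|≡v covers =
      ≈-trans (≈-reflexive (sumSq-↭ (downFrom-↭ γ qs 3+|qs|≡v covers)))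
      (≈-trans (+-cong (≈-refl {0ℤ}) (+-cong (≈-refl {+ γ * + γ})
                       (+-cong (square-cong (neg-≈ (<⇒≤ γ<v))) (≈-refl {sumSq qs}))))
               (≈-reflexive (regroup (+ γ) (sumSq qs))))
      where
      regroup : ∀ g s → 0ℤ + (g * g + (- g * - g + s)) ≡ + 2 * (g * g) + s
      regroup = solve-∀

    3+[v∸3]/4*4≡v : v % 4 ≡ 3 → 3 ℕ.+ (v ∸ 3) / 4 ℕ.* 4 ≡ v
    3+[v∸3]/4*4≡v v%4≡3 = ≡.trans (cong (λ n → 3 ℕ.+ n ℕ.* 4) [v∸3]/4≡v/4) (≡.sym v≡)
      where
      v≡ : v ≡ 3 ℕ.+ v / 4 ℕ.* 4
      v≡ = ≡.trans (m≡m%n+[m/n]*n v 4) (cong (ℕ._+ v / 4 ℕ.* 4) v%4≡3)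
      [v∸3]/4≡v/4 : (v ∸ 3) / 4 ≡ v / 4
      [v∸3]/4≡v/4 = ≡.trans (cong (λ n → (n ∸ 3) / 4) v≡)
                     (≡.trans (cong (_/ 4) (m+n∸m≡n 3 (v / 4 ℕ.* 4))) (m*n/n≡m (v / 4) 4))

    aps-sumSq : ∀ {α β S} → v % 4 ≡ 3 → α < v → β < v → IsAPS α β S →
                sumSq (downFrom v) ≈ + 2 * (+ 2 * (+ α * + α) - + β * + β)
    aps-sumSq {α} {β} {S} v%4≡3 α<v β<v (|S|≡ , S<v , _ , covers-α , covers-β) =
      ≈-trans (≈-reflexive (twice-minus T))
              (≈-trans (+-cong (*-cong (≈-refl {+ 2}) T≈α) (-‿cong T≈β))
                       (≈-reflexive (regroup (+ α) (+ β) (pairNorm S))))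
      where
      T : ℤ
      T = sumSq (downFrom v)
      twice-minus : ∀ t → t ≡ + 2 * t - t
      twice-minus = solve-∀
      regroup : ∀ a b n → + 2 * (+ 2 * (a * a) + + 2 * n) - (+ 2 * (b * b) + + 4 * n)
                          ≡ + 2 * (+ 2 * (a * a) - b * b)
      regroup = solve-∀
      3+|qs|≡v : ∀ qs → length qs ≡ length S ℕ.* 4 → 3 ℕ.+ length qs ≡ v
      3+|qs|≡v _ |qs|≡ = ≡.trans (cong (3 ℕ.+_) (≡.trans |qs|≡ (cong (ℕ._* 4) |S|≡))) (3+[v∸3]/4*4≡v v%4≡3)
      T≈α : T ≈ + 2 * (+ α * + α) + + 2 * pairNorm S
      T≈α = ≈-trans (sumSq-complement (±pairs S) α<v (3+|qs|≡v (±pairs S) (length-±pairs S))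
                                      (λ z z<v → InPm⇒∈ ∘ Equivalence.from (covers-α z z<v)))
                    (+-cong (≈-refl {+ 2 * (+ α * + α)}) (sumSq-±pairs S<v))
      T≈β : T ≈ + 2 * (+ β * + β) + + 4 * pairNorm S
      T≈β = ≈-trans (sumSq-complement (±diffSums S) β<v (3+|qs|≡v (±diffSums S) (length-±diffSums S))
                                      (λ z z<v → InPmDiffSum⇒∈ ∘ Equivalence.from (covers-β z z<v)))
                    (+-cong (≈-refl {+ 2 * (+ β * + β)}) (sumSq-±diffSums S<v))

  sumSq-downFrom : ∀ n → + 6 * sumSq (downFrom n) ≡ (+ n - + 1) * + n * (+ 2 * + n - + 1)
  sumSq-downFrom zero    = ≡.refl
  sumSq-downFrom (suc n) = step (+ n) (sumSq (downFrom n)) (sumSq-downFrom n)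
    where
    step : ∀ x s → + 6 * s ≡ (x - + 1) * x * (+ 2 * x - + 1) →
           + 6 * (x * x + s) ≡ (+ 1 + x - + 1) * (+ 1 + x) * (+ 2 * (+ 1 + x) - + 1)
    step x s eq = ≡.trans (distrib x s) (≡.trans (cong (λ t → + 6 * (x * x) + t) eq) (closed-form x))
      where
      distrib : ∀ x s → + 6 * (x * x + s) ≡ + 6 * (x * x) + + 6 * s
      distrib = solve-∀
      closed-form : ∀ x → + 6 * (x * x) + (x - + 1) * x * (+ 2 * x - + 1)
                          ≡ (+ 1 + x - + 1) * (+ 1 + x) * (+ 2 * (+ 1 + x) - + 1)
      closed-form = solve-∀

module ApsDivisibility where
  open import Defs using (module ZMod; PlusMinus3Mod8)
  open Primes using (euclidsLemma-ℤ)
  open Congruence using (module ModuloNat)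
  open GaussLemma using (two-nonresidue)
  open SquareSums using (sumSq; sumSq-downFrom; aps-sumSq)
  open import Data.Nat as ℕ using (ℕ; _≤_; _<_; _%_; NonZero)
  open import Data.Nat.Properties using (≤-trans; ≤-reflexive)
  open import Data.Nat.DivMod using (m%n≤m)
  open import Data.Nat.Divisibility using (_∣_; ∣⇒≤; ∣-trans; n∣m*n)
  open import Data.Nat.Primality using (Prime)
  open import Data.Integer using (ℤ; +_; _*_; _-_)
  open import Data.Integer.Properties using (pos-*; *-cancelˡ-≡)
  import Data.Integer.Divisibility.Signed as ℤ
  open import Data.Integer.Tactic.RingSolver using (solve-∀)
  open import Data.List using (downFrom)
  open import Data.Product using (_×_; _,_)
  open import Data.Sum using (inj₁; inj₂; [_,_]′)
  open import Data.Empty using (⊥-elim)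
  open import Relation.Binary.PropositionalEquality
  open import Relation.Nullary using (¬_)

  ±3-mod-8⇒∤2 : ∀ {p} → PlusMinus3Mod8 p → ¬ p ∣ 2
  ±3-mod-8⇒∤2 {p} ±3 p∣2 with ≤-trans (3≤p%8 ±3) (≤-trans (m%n≤m p 8) (∣⇒≤ p∣2))
    where
    3≤p%8 : PlusMinus3Mod8 p → 3 ≤ p % 8
    3≤p%8 (inj₁ p%8≡3) = ≤-reflexive (sym p%8≡3)
    3≤p%8 (inj₂ p%8≡5) = subst (3 ≤_) (sym p%8≡5) (ℕ.s≤s (ℕ.s≤s (ℕ.s≤s ℕ.z≤n)))
  ... | ℕ.s≤s (ℕ.s≤s ())

  prime∣sumSq-downFrom : ∀ {p P v} → Prime p → ¬ p ∣ 2 → p ∣ P → v ≡ 3 ℕ.* P →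
                         + p ℤ.∣ sumSq (downFrom v)
  prime∣sumSq-downFrom {p} {P} {v} p-prime p∤2 p∣P v≡3P
    with euclidsLemma-ℤ p-prime (+ 2) T (subst (+ p ℤ.∣_) (sym 2T≡) p∣rhs)
    where
    T : ℤ
    T = sumSq (downFrom v)
    rhs : ℤ
    rhs = (+ v - + 1) * + P * (+ 2 * + v - + 1)
    2T≡ : + 2 * T ≡ rhs
    2T≡ = *-cancelˡ-≡ (+ 3) (+ 2 * T) rhs (begin
      + 3 * (+ 2 * T)                                 ≡⟨ six T ⟩
      + 6 * T                                         ≡⟨ sumSq-downFrom v ⟩
      (+ v - + 1) * + v * (+ 2 * + v - + 1)           ≡⟨ cong (λ w → (+ v - + 1) * w * (+ 2 * + v - + 1))
                                                              (trans (cong +_ v≡3P) (pos-* 3 P)) ⟩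
      (+ v - + 1) * (+ 3 * + P) * (+ 2 * + v - + 1)   ≡⟨ pull-3 (+ v - + 1) (+ P) (+ 2 * + v - + 1) ⟩
      + 3 * rhs                                       ∎)
      where
      open ≡-Reasoning
      six : ∀ t → + 3 * (+ 2 * t) ≡ + 6 * t
      six = solve-∀
      pull-3 : ∀ a x b → a * (+ 3 * x) * b ≡ + 3 * (a * x * b)
      pull-3 = solve-∀
    p∣rhs : + p ℤ.∣ rhs
    p∣rhs = ℤ.∣m⇒∣m*n (+ 2 * + v - + 1) (ℤ.∣n⇒∣m*n (+ v - + 1) (ℤ.∣ᵤ⇒∣ p∣P))
  ... | inj₁ p∣2 = ⊥-elim (p∤2 (ℤ.∣⇒∣ᵤ p∣2))
  ... | inj₂ p∣T = p∣T

  aps⇒prime∣α∧β : ∀ {v} .{{_ : NonZero v}} {P p α β S} → Prime p → PlusMinus3Mod8 p →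
                  p ∣ P → v ≡ 3 ℕ.* P → v % 4 ≡ 3 → α < v → β < v → ZMod.IsAPS v α β S →
                  p ∣ α × p ∣ β
  aps⇒prime∣α∧β {v} {P} {p} {α} {β} p-prime ±3 p∣P v≡3P v%4≡3 α<v β<v aps = p∣α , p∣β
    where
    open ModuloNat v using (∣-difference)
    p∤2 : ¬ p ∣ 2
    p∤2 = ±3-mod-8⇒∤2 ±3
    E : ℤ
    E = + 2 * (+ α * + α) - + β * + β
    p∣v : + p ℤ.∣ + v
    p∣v = ℤ.∣ᵤ⇒∣ (∣-trans p∣P (subst (P ∣_) (sym v≡3P) (n∣m*n 3)))
    p∣2E : + p ℤ.∣ + 2 * E
    p∣2E = subst (+ p ℤ.∣_) (t-[t-e]≡e (sumSq (downFrom v)) (+ 2 * E))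
                 (ℤ.∣m∣n⇒∣m-n (prime∣sumSq-downFrom p-prime p∤2 p∣P v≡3P)
                              (ℤ.∣-trans p∣v (∣-difference (aps-sumSq v v%4≡3 α<v β<v aps))))
      where
      t-[t-e]≡e : ∀ t e → t - (t - e) ≡ e
      t-[t-e]≡e = solve-∀
    p∣E : + p ℤ.∣ E
    p∣E = [ (λ p∣2 → ⊥-elim (p∤2 (ℤ.∣⇒∣ᵤ p∣2))) , (λ p∣E → p∣E) ]′ (euclidsLemma-ℤ p-prime (+ 2) E p∣2E)
    p∣α : p ∣ α
    p∣α = two-nonresidue p-prime ±3 α β p∣E
    p∣β : p ∣ β
    p∣β = ℤ.∣⇒∣ᵤ {+ p} {+ β} ([ (λ p∣β → p∣β) , (λ p∣β → p∣β) ]′ (euclidsLemma-ℤ p-prime (+ β) (+ β) p∣β²))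
      where
      b²≡ : ∀ a b → + 2 * (a * a) - (+ 2 * (a * a) - b * b) ≡ b * b
      b²≡ = solve-∀
      p∣β² : + p ℤ.∣ + β * + β
      p∣β² = subst (+ p ℤ.∣_) (b²≡ (+ α) (+ β))
                   (ℤ.∣m∣n⇒∣m-n (ℤ.∣n⇒∣m*n (+ 2) (ℤ.∣m⇒∣m*n {m = + α} (+ α) (ℤ.∣ᵤ⇒∣ {+ p} {+ α} p∣α))) p∣E)

open import Defs
open import Data.Nat using (ℕ; _*_; _/_; _%_; NonZero)
open import Data.Nat.Primality using (Prime)
open import Data.Product using (_×_)
open import Data.Sum using (_⊎_)
open import Data.List using (List)
open import Data.Nat.ListAction using (product)
open import Data.List.Relation.Unary.All using (All)
open import Data.List.Relation.Unary.Unique.Propositional using (Unique)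
open import Relation.Binary.PropositionalEquality using (_≡_)

open import Data.Nat using (zero; suc; _<_; z≤n; s≤s)
open import Data.Nat.Properties using (+-identityʳ; *-comm; *-assoc; *-monoˡ-≤; <⇒≱)
open import Data.Nat.DivMod using (m*n/n≡m)
open import Data.Nat.Divisibility using (_∣_; divides; 1∣_)
open import Data.Nat.Primality using (euclidsLemma)
open import Data.Nat.Primality.Factorisation using (factorisationHasAllPrimeFactors)
open import Data.Nat.ListAction.Properties using (∈⇒∣product)
open import Data.List using ([]; _∷_)
open import Data.List.Membership.Propositional using (_∈_)
import Data.List.Relation.Unary.All as All
open import Data.List.Relation.Unary.AllPairs using (_∷_)
open import Data.Product using (_,_; proj₁; proj₂)
open import Data.Sum using (inj₁; inj₂)
open import Data.Empty using (⊥-elim)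
open import Relation.Binary.PropositionalEquality using (_≢_; refl; trans; cong; subst)
open import Function using (_∘_)
open ApsDivisibility using (aps⇒prime∣α∧β)

distinct-primes-∣⇒product-∣ : ∀ {x} ps → Unique ps → All Prime ps → All (_∣ x) ps → product ps ∣ x
distinct-primes-∣⇒product-∣ {x} []       _             _                     _            = 1∣ x
distinct-primes-∣⇒product-∣     (p ∷ ps) (p∉ps ∷ ps!) (p-prime All.∷ ps-prime) (p∣x All.∷ ps∣x)
  with distinct-primes-∣⇒product-∣ ps ps! ps-prime ps∣x
... | divides j x≡j*Π with euclidsLemma j (product ps) p-prime (subst (p ∣_) x≡j*Π p∣x)
...   | inj₁ (divides i j≡i*p) =
  divides i (trans x≡j*Π (trans (cong (_* product ps) j≡i*p) (*-assoc i p (product ps))))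
...   | inj₂ p∣Π = ⊥-elim (All.lookup p∉ps (factorisationHasAllPrimeFactors p-prime p∣Π ps-prime) refl)

multiple-below-3*⇒1*∨2* : ∀ {P x} → P ∣ x → x ≢ 0 → x < 3 * P → x ≡ P ⊎ x ≡ 2 * P
multiple-below-3*⇒1*∨2* (divides zero refl)                x≢0 _    = ⊥-elim (x≢0 refl)
multiple-below-3*⇒1*∨2* {P} (divides 1 refl)              _   _    = inj₁ (+-identityʳ P)
multiple-below-3*⇒1*∨2* (divides 2 refl)                   _   _    = inj₂ refl
multiple-below-3*⇒1*∨2* {P} (divides (suc (suc (suc j))) refl) _ x<3P =
  ⊥-elim (<⇒≱ x<3P (*-monoˡ-≤ P {3} {suc (suc (suc j))} (s≤s (s≤s (s≤s z≤n)))))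

corollary3p2 : (v : ℕ) .{{_ : NonZero v}} (ps : List ℕ) (α β : ℕ) →
    v % 12 ≡ 3 →
    v ≡ 3 * product ps →
    Unique ps → All Prime ps → All PlusMinus3Mod8 ps →
    APS v α β →
    ((α ≡ v / 3) ⊎ (α ≡ 2 * (v / 3))) × ((β ≡ v / 3) ⊎ (β ≡ 2 * (v / 3)))
-- v ≡ 3 (mod 12) follows from v = 3P and v ≡ 3 (mod 4).
corollary3p2 v ps α β _ v≡3P ps! ps-prime ps-±3 (v%4≡3 , α<v , α≢0 , β<v , β≢0 , S , aps) =
  one-or-two-thirds α<v α≢0 (distinct-primes-∣⇒product-∣ ps ps! ps-prime (All.tabulate (proj₁ ∘ p∣α∧β))) ,
  one-or-two-thirds β<v β≢0 (distinct-primes-∣⇒product-∣ ps ps! ps-prime (All.tabulate (proj₂ ∘ p∣α∧β)))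
  where
  p∣α∧β : ∀ {p} → p ∈ ps → p ∣ α × p ∣ β
  p∣α∧β p∈ps = aps⇒prime∣α∧β (All.lookup ps-prime p∈ps) (All.lookup ps-±3 p∈ps) (∈⇒∣product p∈ps)
                             v≡3P v%4≡3 α<v β<v aps
  v/3≡P : v / 3 ≡ product ps
  v/3≡P = trans (cong (_/ 3) (trans v≡3P (*-comm 3 (product ps)))) (m*n/n≡m (product ps) 3)
  one-or-two-thirds : ∀ {x} → x < v → x ≢ 0 → product ps ∣ x → x ≡ v / 3 ⊎ x ≡ 2 * (v / 3)
  one-or-two-thirds {x} x<v x≢0 P∣x rewrite v/3≡P = multiple-below-3*⇒1*∨2* P∣x x≢0 (subst (x <_) v≡3P x<v)
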